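{- Let $A$ be a commutative unital ring and $n\ge4$ an integer. Then $M_n(1_A,n_A-2_A,1_A,2_A,\ldots,2_A)=-Id$, where the tuple has $n$ entries, the last $n-3$ of which are equal to $2_A$.
   Context: For $a_1,\ldots,a_n\in A$, $M_n(a_1,\ldots,a_n)=\begin{pmatrix}a_n&-1\\1&0\end{pmatrix}\cdots\begin{pmatrix}a_1&-1\\1&0\end{pmatrix}$. For $k\in\mathbb{N}^*$, $k_A=\sum_{i=1}^k 1_A$. -}

module Defs where

open import Level using (Level)
open import Algebra.Bundles using (CommutativeRing)
open import Data.Nat using (ℕ; zero; suc)
open import Data.List using (List; []; _∷_; length)
open import Data.Product using (_×_; _,_)

module Mat {c ℓ : Level} (A : CommutativeRing c ℓ) where
  open CommutativeRing A

  record M2 : Set c where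
    constructor mat
    field
      m11 m12 m21 m22 : Carrier
  open M2 public

  _⊗_ : M2 → M2 → M2
  mat a b c' d ⊗ mat e f g h =
    mat (a * e + b * g) (a * f + b * h) (c' * e + d * g) (c' * f + d * h)

  _≈M_ : M2 → M2 → Set ℓ
  X ≈M Y = (m11 X ≈ m11 Y) × (m12 X ≈ m12 Y) × (m21 X ≈ m21 Y) × (m22 X ≈ m22 Y)

  Id : M2
  Id = mat 1# 0# 0# 1#

  negId : M2
  negId = mat (- 1#) 0# 0# (- 1#)

  E : Carrier → M2
  E a = mat a (- 1#) 1# 0#

  -- M(a₁,…,aₙ) = E aₙ ⋯ E a₁ ; the list is [a₁, …, aₙ]
  Mlist : List Carrier → M2
  Mlist [] = Id
  Mlist (a ∷ as) = Mlist as ⊗ E a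

  _ₐ : ℕ → Carrier
  zero ₐ = 0#
  suc k ₐ = 1# + k ₐ

-- Write U k for the matrix (1+k, -k ; k, 1-k) = Id + k N with N = (1, -1 ; 1, -1). Since N² = 0,
-- U k ⊗ U l = U (k + l), and E 2 = U 1, so the n − 3 trailing entries 2 contribute U (n − 3).
-- The three leading entries give E 1 ⊗ E (n − 2) ⊗ E 1 = −U (3 − n), the inverse of U (n − 3) up to sign.
-- Every step is a polynomial identity with integer coefficients, so the ring solver applies once ℤ
-- is mapped into A.
module Submission where

open import Defs
open import Level using (Level; 0ℓ)
open import Algebra.Bundles using (CommutativeRing; RawRing)
open import Algebra.Solver.Ring.AlmostCommutativeRing
  using (fromCommutativeRing; _-Raw-AlmostCommutative⟶_)
open import Data.Nat as ℕ using (ℕ; zero; suc; _≤_; _∸_; s≤s)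
open import Data.List using (_∷_; replicate)
open import Data.Product using (_×_; _,_)
open import Data.Maybe using (Maybe; just; nothing)
open import Relation.Nullary using (yes)
open import Relation.Binary.PropositionalEquality as ≡ using (_≡_)

module IntegerCoefficients {c ℓ : Level} (A : CommutativeRing c ℓ) where
  open CommutativeRing A hiding (zero)
  open Mat A using (_ₐ)
  open import Algebra.Properties.Ring ring using (-0#≈0#; -‿+-comm; -‿involutive; -‿distribˡ-*; -‿distribʳ-*; ⁻¹-anti-homo‿-)
  open import Algebra.Properties.Semiring.Mult semiring using (×-homo-+; ×1-homo-*) renaming (_×_ to _×ₙ_)
  open import Algebra.Properties.CommutativeSemigroup +-commutativeSemigroup using (interchange)
  open import Relation.Binary.Reasoning.Setoid setoid

  -- (a , b) stands for the integer a − b. The solver compares coefficients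
  -- syntactically, so arithmetic keeps pairs reduced by cancel.
  Diff : Set
  Diff = ℕ × ℕ

  cancel : Diff → Diff
  cancel (suc a , suc b) = cancel (a , b)
  cancel d               = d

  _+ᴰ_ _*ᴰ_ : Diff → Diff → Diff
  (a , b) +ᴰ (a′ , b′) = cancel (a ℕ.+ a′ , b ℕ.+ b′)
  (a , b) *ᴰ (a′ , b′) = cancel (a ℕ.* a′ ℕ.+ b ℕ.* b′ , a ℕ.* b′ ℕ.+ b ℕ.* a′)

  -ᴰ_ : Diff → Diff
  -ᴰ (a , b) = (b , a)

  diffRawRing : RawRing 0ℓ 0ℓ
  diffRawRing = record
    { Carrier = Diff ; _≈_ = _≡_ ; _+_ = _+ᴰ_ ; _*_ = _*ᴰ_ ; -_ = -ᴰ_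
    ; 0# = (0 , 0) ; 1# = (1 , 0) }

  -- 0, 1 and −1 are sent to 0#, 1# and - 1# on the nose, so that solved
  -- equations mention exactly the constants of the matrices E a.
  ⟦_⟧ᴰ : Diff → Carrier
  ⟦ 0 , 0 ⟧ᴰ = 0#
  ⟦ 1 , 0 ⟧ᴰ = 1#
  ⟦ 0 , 1 ⟧ᴰ = - 1#
  ⟦ a , b ⟧ᴰ = a ₐ - b ₐ

  ⟦⟧ᴰ-≈ : ∀ a b → ⟦ a , b ⟧ᴰ ≈ a ₐ - b ₐ
  ⟦⟧ᴰ-≈ 0             0             = sym (-‿inverseʳ 0#)
  ⟦⟧ᴰ-≈ 1             0             = sym (trans (+-congˡ -0#≈0#) (trans (+-identityʳ _) (+-identityʳ 1#)))
  ⟦⟧ᴰ-≈ 0             1             = sym (trans (+-identityˡ _) (-‿cong (+-identityʳ 1#)))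
  ⟦⟧ᴰ-≈ 0             (suc (suc b)) = refl
  ⟦⟧ᴰ-≈ 1             (suc b)       = refl
  ⟦⟧ᴰ-≈ (suc (suc a)) b             = refl

  ₐ≡×1# : ∀ n → n ₐ ≡ n ×ₙ 1#
  ₐ≡×1# zero    = ≡.refl
  ₐ≡×1# (suc n) = ≡.cong (1# +_) (ₐ≡×1# n)

  ₐ-homo-+ : ∀ m n → (m ℕ.+ n) ₐ ≈ m ₐ + n ₐ
  ₐ-homo-+ m n rewrite ₐ≡×1# m | ₐ≡×1# n | ₐ≡×1# (m ℕ.+ n) = ×-homo-+ 1# m n

  ₐ-homo-* : ∀ m n → (m ℕ.* n) ₐ ≈ m ₐ * n ₐ
  ₐ-homo-* m n rewrite ₐ≡×1# m | ₐ≡×1# n | ₐ≡×1# (m ℕ.* n) = ×1-homo-* m n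

  [p+r]-[q+s]≈[p-q]+[r-s] : ∀ p q r s → (p + r) - (q + s) ≈ (p - q) + (r - s)
  [p+r]-[q+s]≈[p-q]+[r-s] p q r s = trans (+-congˡ (sym (-‿+-comm q s))) (interchange p r (- q) (- s))

  [pr+qs]-[ps+qr]≈[p-q][r-s] : ∀ p q r s → (p * r + q * s) - (p * s + q * r) ≈ (p - q) * (r - s)
  [pr+qs]-[ps+qr]≈[p-q][r-s] p q r s = sym (begin
    (p - q) * (r - s)                              ≈⟨ distribʳ _ _ _ ⟩
    p * (r - s) + - q * (r - s)                    ≈⟨ +-cong (distribˡ _ _ _) (distribˡ _ _ _) ⟩
    (p * r + p * - s) + (- q * r + - q * - s)      ≈⟨ +-cong (+-congˡ (-‿distribʳ-* p s)) (+-cong (-‿distribˡ-* q r) (sym -q*-s≈qs)) ⟨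
    (p * r + - (p * s)) + (- (q * r) + q * s)      ≈⟨ +-congˡ (+-comm _ _) ⟩
    (p * r + - (p * s)) + (q * s + - (q * r))      ≈⟨ interchange _ _ _ _ ⟩
    (p * r + q * s) + (- (p * s) + - (q * r))      ≈⟨ +-congˡ (-‿+-comm _ _) ⟩
    (p * r + q * s) - (p * s + q * r)              ∎)
    where
    -q*-s≈qs : - q * - s ≈ q * s
    -q*-s≈qs = trans (sym (-‿distribˡ-* q (- s))) (trans (-‿cong (sym (-‿distribʳ-* q s))) (-‿involutive _))

  ⟦cancel⟧ᴰ : ∀ a b → ⟦ cancel (a , b) ⟧ᴰ ≈ a ₐ - b ₐ
  ⟦cancel⟧ᴰ (suc a) (suc b) = begin
    ⟦ cancel (a , b) ⟧ᴰ           ≈⟨ ⟦cancel⟧ᴰ a b ⟩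
    a ₐ - b ₐ                     ≈⟨ +-identityˡ _ ⟨
    0# + (a ₐ - b ₐ)              ≈⟨ +-congʳ (-‿inverseʳ 1#) ⟨
    (1# - 1#) + (a ₐ - b ₐ)       ≈⟨ [p+r]-[q+s]≈[p-q]+[r-s] 1# 1# (a ₐ) (b ₐ) ⟨
    (1# + a ₐ) - (1# + b ₐ)       ∎
  ⟦cancel⟧ᴰ zero    b    = ⟦⟧ᴰ-≈ zero b
  ⟦cancel⟧ᴰ (suc a) zero = ⟦⟧ᴰ-≈ (suc a) zero

  ⟦⟧ᴰ-homomorphism : diffRawRing -Raw-AlmostCommutative⟶ fromCommutativeRing A
  ⟦⟧ᴰ-homomorphism = record
    { ⟦_⟧    = ⟦_⟧ᴰ
    ; +-homo = λ { (a , b) (a′ , b′) → begin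
        ⟦ cancel (a ℕ.+ a′ , b ℕ.+ b′) ⟧ᴰ   ≈⟨ ⟦cancel⟧ᴰ (a ℕ.+ a′) (b ℕ.+ b′) ⟩
        (a ℕ.+ a′) ₐ - (b ℕ.+ b′) ₐ         ≈⟨ +-cong (ₐ-homo-+ a a′) (-‿cong (ₐ-homo-+ b b′)) ⟩
        (a ₐ + a′ ₐ) - (b ₐ + b′ ₐ)         ≈⟨ [p+r]-[q+s]≈[p-q]+[r-s] _ _ _ _ ⟩
        (a ₐ - b ₐ) + (a′ ₐ - b′ ₐ)         ≈⟨ +-cong (⟦⟧ᴰ-≈ a b) (⟦⟧ᴰ-≈ a′ b′) ⟨
        ⟦ a , b ⟧ᴰ + ⟦ a′ , b′ ⟧ᴰ           ∎ }
    ; *-homo = λ { (a , b) (a′ , b′) → begin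
        ⟦ cancel (a ℕ.* a′ ℕ.+ b ℕ.* b′ , a ℕ.* b′ ℕ.+ b ℕ.* a′) ⟧ᴰ
          ≈⟨ ⟦cancel⟧ᴰ (a ℕ.* a′ ℕ.+ b ℕ.* b′) (a ℕ.* b′ ℕ.+ b ℕ.* a′) ⟩
        (a ℕ.* a′ ℕ.+ b ℕ.* b′) ₐ - (a ℕ.* b′ ℕ.+ b ℕ.* a′) ₐ
          ≈⟨ +-cong (ₐ-sum-of-products a a′ b b′) (-‿cong (ₐ-sum-of-products a b′ b a′)) ⟩
        (a ₐ * a′ ₐ + b ₐ * b′ ₐ) - (a ₐ * b′ ₐ + b ₐ * a′ ₐ)          ≈⟨ [pr+qs]-[ps+qr]≈[p-q][r-s] _ _ _ _ ⟩
        (a ₐ - b ₐ) * (a′ ₐ - b′ ₐ)                                     ≈⟨ *-cong (⟦⟧ᴰ-≈ a b) (⟦⟧ᴰ-≈ a′ b′) ⟨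
        ⟦ a , b ⟧ᴰ * ⟦ a′ , b′ ⟧ᴰ                                       ∎ }
    ; -‿homo = λ { (a , b) → trans (⟦⟧ᴰ-≈ b a) (trans (sym (⁻¹-anti-homo‿- (a ₐ) (b ₐ))) (-‿cong (sym (⟦⟧ᴰ-≈ a b)))) }
    ; 0-homo = refl
    ; 1-homo = refl
    }
    where
    ₐ-sum-of-products : ∀ p q r s → (p ℕ.* q ℕ.+ r ℕ.* s) ₐ ≈ p ₐ * q ₐ + r ₐ * s ₐ
    ₐ-sum-of-products p q r s = trans (ₐ-homo-+ (p ℕ.* q) (r ℕ.* s)) (+-cong (ₐ-homo-* p q) (ₐ-homo-* r s))

  _≟ᴰ_ : ∀ d d′ → Maybe (⟦ d ⟧ᴰ ≈ ⟦ d′ ⟧ᴰ)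
  (a , b) ≟ᴰ (a′ , b′) with a ℕ.≟ a′ | b ℕ.≟ b′
  ... | yes ≡.refl | yes ≡.refl = just refl
  ... | _          | _          = nothing

  open import Algebra.Solver.Ring diffRawRing (fromCommutativeRing A) ⟦⟧ᴰ-homomorphism _≟ᴰ_ public
    using (Polynomial; con; _:+_; _:*_; :-_; _:-_; solve; _:=_)

module Matrices {c ℓ : Level} (A : CommutativeRing c ℓ) where
  open CommutativeRing A hiding (zero)
  open Mat A
  open IntegerCoefficients A

  ≈M-refl : ∀ {X} → X ≈M X
  ≈M-refl = refl , refl , refl , refl

  ≈M-trans : ∀ {X Y Z} → X ≈M Y → Y ≈M Z → X ≈M Z
  ≈M-trans (p , q , r , s) (p′ , q′ , r′ , s′) = trans p p′ , trans q q′ , trans r r′ , trans s s′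

  ⊗-cong : ∀ {X X′ Y Y′} → X ≈M X′ → Y ≈M Y′ → (X ⊗ Y) ≈M (X′ ⊗ Y′)
  ⊗-cong (a , b , c′ , d) (e , f , g , h) =
    +-cong (*-cong a e) (*-cong b g) , +-cong (*-cong a f) (*-cong b h) ,
    +-cong (*-cong c′ e) (*-cong d g) , +-cong (*-cong c′ f) (*-cong d h)

  U : Carrier → M2
  U k = mat (1# + k) (- k) k (1# - k)

  -- Matrices of polynomials, multiplied by the formula of _⊗_: the semantics of
  -- an entry of X ⊗ₚ Y is definitionally the entry of the product of the semantics.
  record PolyM2 (n : ℕ) : Set c where
    constructor matₚ
    field p11 p12 p21 p22 : Polynomial n
  open PolyM2

  _⊗ₚ_ : ∀ {n} → PolyM2 n → PolyM2 n → PolyM2 n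
  matₚ a b c′ d ⊗ₚ matₚ e f g h =
    matₚ (a :* e :+ b :* g) (a :* f :+ b :* h) (c′ :* e :+ d :* g) (c′ :* f :+ d :* h)

  0ₚ 1ₚ 2ₚ : ∀ {n} → Polynomial n
  0ₚ = con (0 , 0)
  1ₚ = con (1 , 0)
  2ₚ = 1ₚ :+ (1ₚ :+ 0ₚ)

  Eₚ Uₚ : ∀ {n} → Polynomial n → PolyM2 n
  Eₚ a = matₚ a (:- 1ₚ) 1ₚ 0ₚ
  Uₚ k = matₚ (1ₚ :+ k) (:- k) k (1ₚ :- k)

  Id≈U0 : Id ≈M U 0#
  Id≈U0 = solve 0 (1ₚ := 1ₚ :+ 0ₚ) refl , solve 0 (0ₚ := :- 0ₚ) refl ,
          refl , solve 0 (1ₚ := 1ₚ :- 0ₚ) refl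

  U-⊗-E2 : ∀ k → (U k ⊗ E (2 ₐ)) ≈M U (1# + k)
  U-⊗-E2 k =
    solve 1 (λ x → p11 (Uₚ x ⊗ₚ Eₚ 2ₚ) := p11 (Uₚ (1ₚ :+ x))) refl k ,
    solve 1 (λ x → p12 (Uₚ x ⊗ₚ Eₚ 2ₚ) := p12 (Uₚ (1ₚ :+ x))) refl k ,
    solve 1 (λ x → p21 (Uₚ x ⊗ₚ Eₚ 2ₚ) := p21 (Uₚ (1ₚ :+ x))) refl k ,
    solve 1 (λ x → p22 (Uₚ x ⊗ₚ Eₚ 2ₚ) := p22 (Uₚ (1ₚ :+ x))) refl k

  Mlist-replicate-2 : ∀ k → Mlist (replicate k (2 ₐ)) ≈M U (k ₐ)
  Mlist-replicate-2 zero    = Id≈U0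
  Mlist-replicate-2 (suc k) = ≈M-trans (⊗-cong (Mlist-replicate-2 k) ≈M-refl) (U-⊗-E2 (k ₐ))

  U-⊗-E1-E-E1 : ∀ m → (((U (suc m ₐ) ⊗ E 1#) ⊗ E ((4 ℕ.+ m) ₐ - 2 ₐ)) ⊗ E 1#) ≈M negId
  U-⊗-E1-E-E1 m =
    solve 1 (λ y → p11 (product y) := :- 1ₚ) refl (m ₐ) ,
    solve 1 (λ y → p12 (product y) := 0ₚ) refl (m ₐ) ,
    solve 1 (λ y → p21 (product y) := 0ₚ) refl (m ₐ) ,
    solve 1 (λ y → p22 (product y) := :- 1ₚ) refl (m ₐ)
    where
    product : Polynomial 1 → PolyM2 1
    product y = ((Uₚ (1ₚ :+ y) ⊗ₚ Eₚ 1ₚ) ⊗ₚ Eₚ ((1ₚ :+ (1ₚ :+ (1ₚ :+ (1ₚ :+ y)))) :- 2ₚ)) ⊗ₚ Eₚ 1ₚ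

mainTheorem15 : ∀ {c ℓ : Level} (A : CommutativeRing c ℓ) (n : ℕ) → 4 ≤ n →
    let open CommutativeRing A
        open Mat A
        tuple = 1# ∷ (n ₐ - 2 ₐ) ∷ 1# ∷ replicate (n ∸ 3) (2 ₐ)
    in Mlist tuple ≈M negId
mainTheorem15 A (suc (suc (suc (suc m)))) (s≤s (s≤s (s≤s (s≤s _)))) =
  ≈M-trans (⊗-cong (⊗-cong (⊗-cong (Mlist-replicate-2 (suc m)) ≈M-refl) ≈M-refl) ≈M-refl)
           (U-⊗-E1-E-E1 m)
  where open Matrices A
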